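{- The face poset of the bipermutohedral fan $\Sigma_{E,E}$ is isomorphic to the poset of bisequences on $E$ ordered by adjacent refinement.
   Context: $E=\{0,\ldots,n\}$, $n\ge1$; $\N_{E,E}=\N_E\oplus\N_E$ with $\N_E=\mathbb R^E/\mathbb R(1,\ldots,1)$, points written $(z,w)$. For $k\in E$ the chart is $\mathscr C_k=\{(z,w):\min_{i\in E}(z_i+w_i)=z_k+w_k\}$, with coordinates $Z_i=z_i-z_k$, $W_i=-w_i+w_k$, so $\mathscr C_k=\{Z_i\ge W_i\ \forall i\}$. Let $\Sigma_k$ be the subdivision of $\mathscr C_k$ by all hyperplanes $Z_a=Z_b$, $W_a=W_b$, $Z_a=W_b$ ($a,b\in E$). The bipermutohedral fan $\Sigma_{E,E}$ is the union of the $\Sigma_k$, $k\in E$ (a complete fan). A bisequence on $E$ is a finite sequence of nonempty subsets of $E$ (parts) such that every element of $E$ appears in at least one and at most two parts and some element appears in exactly one part. The poset order: $\mathscr B\le\mathscr B'$ if $\mathscr B$ is obtained from $\mathscr B'$ by merging adjacent parts (taking unions).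
   Formalization: Points of $\N_{E,E}$ are represented by pairs with rational coordinates instead of real ones, so the cones of $\Sigma_{E,E}$ are sets of rational points. -}

module Defs where

open import Data.Nat using (ℕ; suc; zero)
open import Data.Fin using (Fin)
open import Data.Fin.Subset using (Subset; _∪_; Nonempty)
open import Data.Fin.Subset.Properties using (_∈?_)
open import Data.Rational using (ℚ; _+_; _-_; _≤_; _<_)
open import Data.List using (List; []; _∷_; _++_; length; filter)
open import Data.Product using (Σ; ∃; _×_; _,_; proj₁)
open import Data.Sum using (_⊎_; inj₁; inj₂)
open import Function.Bundles using (_⇔_)
open import Relation.Binary.PropositionalEquality using (_≡_)
open import Relation.Binary.Construct.Closure.ReflexiveTransitive using (Star)

-- The ground set E = {0,…,n} is Fin (suc n).

-- N_{E,E} is the quotient by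
-- (constants , constants); we work with representatives: every set
-- below is invariant under adding constants to z and to w, so it is the
-- preimage of a subset of N_{E,E}, and inclusion of preimages is
-- inclusion of the subsets.
Point : ℕ → Set
Point n = (Fin (suc n) → ℚ) × (Fin (suc n) → ℚ)

InChart : ∀ {n} → Fin (suc n) → Point n → Set
InChart k (z , w) = ∀ i → z k + w k ≤ z i + w i

coord : ∀ {n} → Fin (suc n) → Point n → Fin (suc n) ⊎ Fin (suc n) → ℚ
coord k (z , w) (inj₁ a) = z a - z k
coord k (z , w) (inj₂ a) = w k - w a

-- The hyperplanes of Σ_k are all Z_a = Z_b, W_a = W_b, Z_a = W_b, i.e.
-- X = Y for all pairs X , Y of chart coordinates.  The closed cone of
-- the subdivision whose relative interior contains p is the set of q
-- lying (weakly) on the same side of / on every hyperplane that p does.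
-- (𝒞_k = {Z_i ≥ W_i} is itself cut out by such hyperplanes, so for p in
-- 𝒞_k this cone lies in 𝒞_k.)
ClosedCell : ∀ {n} → Fin (suc n) → Point n → Point n → Set
ClosedCell k p q = ∀ x y →
  (coord k p x < coord k p y → coord k q x ≤ coord k q y) ×
  (coord k p x ≡ coord k p y → coord k q x ≡ coord k q y)

IsCone : ∀ {n} → (Point n → Set) → Set
IsCone {n} σ = Σ (Fin (suc n)) λ k → Σ (Point n) λ p →
  InChart k p × (∀ q → σ q ⇔ ClosedCell k p q)

Cone : ℕ → Set₁
Cone n = Σ (Point n → Set) IsCone

_⊆ᶜ_ : ∀ {n} → Cone n → Cone n → Set
σ ⊆ᶜ τ = ∀ q → proj₁ σ q → proj₁ τ q

_≅ᶜ_ : ∀ {n} → Cone n → Cone n → Set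
σ ≅ᶜ τ = (σ ⊆ᶜ τ) × (τ ⊆ᶜ σ)

occ : ∀ {n} → Fin (suc n) → List (Subset (suc n)) → ℕ
occ i B = length (filter (i ∈?_) B)

data AllNonempty {n : ℕ} : List (Subset n) → Set where
  []  : AllNonempty []
  _∷_ : ∀ {S B} → Nonempty S → AllNonempty B → AllNonempty (S ∷ B)

record Bisequence (n : ℕ) : Set where
  constructor bisequence
  field
    parts    : List (Subset (suc n))
    nonempty : AllNonempty parts
    atLeast1 : ∀ i → 1 Data.Nat.≤ occ i parts
    atMost2  : ∀ i → occ i parts Data.Nat.≤ 2
    someOnce : ∃ λ i → occ i parts ≡ 1

open Bisequence public

MergeStep : ∀ {n} → List (Subset n) → List (Subset n) → Set
MergeStep {n} B' B = Σ (List (Subset n)) λ xs → Σ (Subset n) λ a →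
  Σ (Subset n) λ b → Σ (List (Subset n)) λ ys →
  (B' ≡ xs ++ a ∷ b ∷ ys) × (B ≡ xs ++ (a ∪ b) ∷ ys)

_≼_ : ∀ {n} → Bisequence n → Bisequence n → Set
B ≼ B' = Star MergeStep (parts B') (parts B)

-- A cone of Σ_{E,E} is the closed cell of a point p of a chart 𝒞_k, and it depends only on the
-- weak order of the chart coordinates Z_i, W_i of p, recorded as a dense ranking r onto
-- {0, …, m - 1}. Listing the level sets of r, the t-th part being the set of i with r(Z_i) = t or
-- r(W_i) = t, gives a bisequence: i lies exactly in the parts r(W_i) ≤ r(Z_i), and k in a single
-- part since Z_k = W_k = 0. Conversely a bisequence is read as the ranking that puts W_i at the
-- first and Z_i at the last part containing i, and it is realised by a point in the chart of an
-- element occurring once. Faces correspond to coarsenings of the weak order, and a coarsening of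
-- dense rankings is a sequence of merges of adjacent levels. A face may be given in another chart
-- 𝒞_k', but a point lying in both charts has z_k + w_k = z_k' + w_k', so that its two systems of
-- chart coordinates differ by a translation.

module Submission where

open import Defs
open import Data.Empty using (⊥; ⊥-elim)
open import Data.Fin using (Fin)
open import Data.Fin.Subset using (Subset; _∈_; _∉_; _∪_; Nonempty)
open import Data.Fin.Subset.Properties using (_∈?_; ⊆-antisym; p⊆p∪q; q⊆p∪q; x∈p∪q⁻; x∈p∪q⁺)
open import Data.List using (List; []; _∷_; _++_; length; filter; foldr; applyUpTo; map; allFin)
open import Data.List.Membership.Propositional using (lose) renaming (_∈_ to _∈ˡ_)
open import Data.List.Membership.Propositional.Properties using (∈-++⁺ˡ; ∈-++⁺ʳ; ∈-map⁺; ∈-allFin)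
open import Data.List.Properties using (filter-accept; filter-reject; filter-some; filter-none; filter-notAll)
open import Data.List.Relation.Unary.All as All using ([]; _∷_)
open import Data.List.Relation.Unary.All.Properties using (¬Any⇒All¬)
open import Data.List.Relation.Unary.AllPairs using (AllPairs; []; _∷_)
open import Data.List.Relation.Unary.Any as Any using (Any; here; there; any?; satisfied)
open import Data.Nat using (ℕ; zero; suc; _<_; _≤_; _≟_; z≤n; s≤s; s≤s⁻¹; z<s; pred)
open import Data.Nat.Properties as ℕ using (<-cmp; ≤-<-trans; m≤n⇒m≤1+n)
open import Data.Product using (∃; Σ; _×_; _,_; proj₁; proj₂)
open import Data.Rational using (ℚ; 0ℚ; 1ℚ; _+_; _-_; -_) renaming (_<_ to _<ℚ_; _≤_ to _≤ℚ_)
import Data.Rational.Properties as ℚ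
open import Data.Rational.Solver using (module +-*-Solver)
open import Data.Sum using (_⊎_; inj₁; inj₂; [_,_]′; reduce)
import Data.Sum as Sum
open import Data.Vec using (tabulate)
open import Data.Vec.Properties using (lookup∘tabulate; lookup⇒[]=; []=⇒lookup)
open import Function using (_∘_; id; case_of_)
open import Function.Bundles using (_⇔_; mk⇔; Equivalence)
open import Level using (0ℓ)
open import Relation.Binary using (Rel; IsStrictTotalOrder; tri<; tri≈; tri>)
open import Relation.Binary.PropositionalEquality
  using (_≡_; refl; sym; trans; cong; cong₂; subst; subst₂; module ≡-Reasoning)
open import Relation.Binary.Construct.Closure.ReflexiveTransitive using (Star; ε; _◅_)
open import Relation.Nullary using (¬_; Dec; yes; no; does)
open import Relation.Nullary.Decidable using (_⊎-dec_; _×-dec_; dec-true)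
import Relation.Nullary.Decidable as Dec
open import Relation.Unary using (Pred; Decidable)
open +-*-Solver using (solve; _:+_; _:-_; :-_; _:=_)

module _ {X : Set} where

  Dense : (X → ℕ) → ℕ → Set
  Dense r m = (∀ x → r x < m) × (∀ t → t < m → ∃ λ x → r x ≡ t)

  Coarser : (X → ℕ) → (X → ℕ) → Set
  Coarser s r = ∀ x y → s x < s y → r x < r y

  Coarser-trans : ∀ {t s r : X → ℕ} → Coarser t s → Coarser s r → Coarser t r
  Coarser-trans t⊑s s⊑r x y = s⊑r x y ∘ t⊑s x y

  ≗⇒Coarser : ∀ {r s : X → ℕ} → (∀ x → r x ≡ s x) → Coarser r s
  ≗⇒Coarser r≗s x y = subst₂ _<_ (r≗s x) (r≗s y)

  Coarser-≡ : ∀ {s r : X → ℕ} → Coarser s r → ∀ {x y} → r x ≡ r y → s x ≡ s y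
  Coarser-≡ {s} s⊑r {x} {y} rx≡ry with <-cmp (s x) (s y)
  ... | tri< sx<sy _ _ = ⊥-elim (ℕ.<-irrefl rx≡ry (s⊑r x y sx<sy))
  ... | tri≈ _ sx≡sy _ = sx≡sy
  ... | tri> _ _ sy<sx = ⊥-elim (ℕ.<-irrefl (sym rx≡ry) (s⊑r y x sy<sx))

  dense-≤ : ∀ {r s : X → ℕ} {m} → Dense r m → (∀ x y → suc (r x) ≡ r y → s x < s y) →
            ∀ x → r x ≤ s x
  dense-≤ {r} {s} {m} (bounded , onto) covers x = go (r x) x refl
    where
      go : ∀ t x → r x ≡ t → t ≤ s x
      go zero    x _     = z≤n
      go (suc t) x rx≡1+t with onto t (ℕ.<-trans (ℕ.n<1+n t) (subst (_< m) rx≡1+t (bounded x)))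
      ... | y , ry≡t = ≤-<-trans (go t y ry≡t) (covers y x (trans (cong suc ry≡t) (sym rx≡1+t)))

  dense-width-≤ : ∀ {r s : X → ℕ} {m m'} → Dense r m → Dense s m' → (∀ x → r x ≡ s x) → m ≤ m'
  dense-width-≤ {m = zero}  _            _             _    = z≤n
  dense-width-≤ {m = suc m} (_ , onto) (bounded' , _) r≗s with onto m (ℕ.n<1+n m)
  ... | x , rx≡m = subst (_< _) (trans (sym (r≗s x)) rx≡m) (bounded' x)

  dense-unique : ∀ {r s : X → ℕ} {m m'} → Dense r m → Dense s m' →
                 (∀ x y → suc (r x) ≡ r y → s x < s y) → (∀ x y → suc (s x) ≡ s y → r x < r y) →
                 (∀ x → r x ≡ s x) × m ≡ m'
  dense-unique {r} {s} dr ds r→s s→r =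
    r≗s , ℕ.≤-antisym (dense-width-≤ dr ds r≗s) (dense-width-≤ ds dr (sym ∘ r≗s))
    where
      r≗s : ∀ x → r x ≡ s x
      r≗s x = ℕ.≤-antisym (dense-≤ dr r→s x) (dense-≤ ds s→r x)

collapse : ℕ → ℕ → ℕ
collapse zero    zero    = zero
collapse zero    (suc t) = t
collapse (suc j) zero    = zero
collapse (suc j) (suc t) = suc (collapse j t)

collapse-cancel-< : ∀ j {t u} → collapse j t < collapse j u → t < u
collapse-cancel-< zero    {zero}  {suc u} _       = z<s
collapse-cancel-< zero    {suc t} {suc u} t<u     = s≤s t<u
collapse-cancel-< (suc j) {zero}  {suc u} _       = z<s
collapse-cancel-< (suc j) {suc t} {suc u} (s≤s c) = s≤s (collapse-cancel-< j c)

collapse-< : ∀ j {t u} → t < u → collapse j t < collapse j u ⊎ (t ≡ j × u ≡ suc j)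
collapse-< zero    {zero}  {suc zero}    _         = inj₂ (refl , refl)
collapse-< zero    {zero}  {suc (suc u)} _         = inj₁ z<s
collapse-< zero    {suc t} {suc u}       (s≤s t<u) = inj₁ t<u
collapse-< (suc j) {zero}  {suc u}       _         = inj₁ z<s
collapse-< (suc j) {suc t} {suc u}       (s≤s t<u) with collapse-< j t<u
... | inj₁ c<c'       = inj₁ (s≤s c<c')
... | inj₂ (t≡j , u≡) = inj₂ (cong suc t≡j , cong suc u≡)

collapse-bounded : ∀ {j t m} → j < m → t ≤ m → collapse j t < m
collapse-bounded {zero}  {zero}  j<m _         = j<m
collapse-bounded {zero}  {suc t} _   1+t≤m     = 1+t≤m
collapse-bounded {suc j} {zero}  j<m _         = ≤-<-trans z≤n j<m
collapse-bounded {suc j} {suc t} (s≤s j<m) (s≤s t≤m) = s≤s (collapse-bounded j<m t≤m)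

collapse-section : ∀ j t → ∃ λ u → u ≤ suc t × collapse j u ≡ t
collapse-section zero    t       = suc t , ℕ.≤-refl , refl
collapse-section (suc j) zero    = zero , z≤n , refl
collapse-section (suc j) (suc t) with collapse-section j t
... | u , u≤1+t , c≡t = suc u , s≤s u≤1+t , cong suc c≡t

module _ {X : Set} where

  collapse-dense : ∀ {r : X → ℕ} {m j} → Dense r (suc m) → j < m → Dense (collapse j ∘ r) m
  collapse-dense {r} {m} {j} (bounded , onto) j<m = (λ x → collapse-bounded j<m (s≤s⁻¹ (bounded x))) , onto'
    where
      onto' : ∀ t → t < m → ∃ λ x → collapse j (r x) ≡ t
      onto' t t<m with collapse-section j t
      ... | u , u≤1+t , c≡t with onto u (s≤s (ℕ.≤-trans u≤1+t t<m))
      ...   | x , rx≡u = x , trans (cong (collapse j) rx≡u) c≡t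

  collapse-coarser : ∀ {r r' : X → ℕ} → Coarser r r' → ∀ {x₀ y₀} → suc (r' x₀) ≡ r' y₀ → r x₀ ≡ r y₀ →
                     Coarser r (collapse (r' x₀) ∘ r')
  collapse-coarser {r} {r'} r⊑r' {x₀} {y₀} covers merged x y rx<ry with collapse-< (r' x₀) (r⊑r' x y rx<ry)
  ... | inj₁ c<c'             = c<c'
  ... | inj₂ (r'x≡ , r'y≡) = ⊥-elim (ℕ.<-irrefl rx≡ry rx<ry)
    where
      rx≡ry : r x ≡ r y
      rx≡ry = trans (Coarser-≡ r⊑r' r'x≡) (trans merged (Coarser-≡ r⊑r' (sym (trans r'y≡ covers))))

module IncreasingLists {A : Set} {_≺_ : Rel A 0ℓ} (sto : IsStrictTotalOrder _≡_ _≺_) where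
  open IsStrictTotalOrder sto
    using (compare) renaming (_<?_ to _≺?_; trans to ≺-trans; irrefl to ≺-irrefl; asym to ≺-asym)

  insert : A → List A → List A
  insert v []       = v ∷ []
  insert v (u ∷ us) with compare v u
  ... | tri< _ _ _ = v ∷ u ∷ us
  ... | tri≈ _ _ _ = u ∷ us
  ... | tri> _ _ _ = u ∷ insert v us

  ∈-insert⁺ˡ : ∀ v us → v ∈ˡ insert v us
  ∈-insert⁺ˡ v []       = here refl
  ∈-insert⁺ˡ v (u ∷ us) with compare v u
  ... | tri< _ _ _   = here refl
  ... | tri≈ _ v≡u _ = here v≡u
  ... | tri> _ _ _   = there (∈-insert⁺ˡ v us)

  ∈-insert⁺ʳ : ∀ {w} v us → w ∈ˡ us → w ∈ˡ insert v us
  ∈-insert⁺ʳ v (u ∷ us) w∈ with compare v u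
  ... | tri< _ _ _ = there w∈
  ... | tri≈ _ _ _ = w∈
  ∈-insert⁺ʳ v (u ∷ us) (here w≡u) | tri> _ _ _ = here w≡u
  ∈-insert⁺ʳ v (u ∷ us) (there w∈) | tri> _ _ _ = there (∈-insert⁺ʳ v us w∈)

  ∈-insert⁻ : ∀ {w} v us → w ∈ˡ insert v us → w ≡ v ⊎ w ∈ˡ us
  ∈-insert⁻ v [] (here w≡v) = inj₁ w≡v
  ∈-insert⁻ v (u ∷ us) w∈ with compare v u | w∈
  ... | tri< _ _ _ | here w≡v  = inj₁ w≡v
  ... | tri< _ _ _ | there w∈' = inj₂ w∈'
  ... | tri≈ _ _ _ | w∈'       = inj₂ w∈'
  ... | tri> _ _ _ | here w≡u  = inj₂ (here w≡u)
  ... | tri> _ _ _ | there w∈' with ∈-insert⁻ v us w∈'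
  ...   | inj₁ w≡v  = inj₁ w≡v
  ...   | inj₂ w∈us = inj₂ (there w∈us)

  insert-increasing : ∀ v us → AllPairs _≺_ us → AllPairs _≺_ (insert v us)
  insert-increasing v []       _            = [] ∷ []
  insert-increasing v (u ∷ us) (u≺us ∷ inc) with compare v u
  ... | tri< v≺u _ _ = (v≺u ∷ All.map (≺-trans v≺u) u≺us) ∷ u≺us ∷ inc
  ... | tri≈ _ _ _   = u≺us ∷ inc
  ... | tri> _ _ u≺v = All.tabulate u≺insert ∷ insert-increasing v us inc
    where
      u≺insert : ∀ {w} → w ∈ˡ insert v us → u ≺ w
      u≺insert w∈ with ∈-insert⁻ v us w∈
      ... | inj₁ refl = u≺v
      ... | inj₂ w∈us = All.lookup u≺us w∈us

  countBelow : A → List A → ℕ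
  countBelow v us = length (filter (_≺? v) us)

  countBelow-mono : ∀ {v v'} us → v ≺ v' → countBelow v us ≤ countBelow v' us
  countBelow-mono []       _    = z≤n
  countBelow-mono {v} {v'} (u ∷ us) v≺v' with u ≺? v | u ≺? v'
  ... | yes _   | yes _    = s≤s (countBelow-mono us v≺v')
  ... | yes u≺v | no  u⊀v' = ⊥-elim (u⊀v' (≺-trans u≺v v≺v'))
  ... | no  _   | yes _    = m≤n⇒m≤1+n (countBelow-mono us v≺v')
  ... | no  _   | no  _    = countBelow-mono us v≺v'

  countBelow-strict : ∀ {v v'} us → v ≺ v' → v ∈ˡ us → countBelow v us < countBelow v' us
  countBelow-strict {v} {v'} (u ∷ us) v≺v' v∈ with u ≺? v | u ≺? v' | v∈
  ... | yes u≺v | _        | here refl = ⊥-elim (≺-irrefl refl u≺v)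
  ... | no  _   | yes _    | here refl = s≤s (countBelow-mono us v≺v')
  ... | _       | no  u⊀v' | here refl = ⊥-elim (u⊀v' v≺v')
  ... | yes _   | yes _    | there v∈' = s≤s (countBelow-strict us v≺v' v∈')
  ... | yes u≺v | no  u⊀v' | there _   = ⊥-elim (u⊀v' (≺-trans u≺v v≺v'))
  ... | no  _   | yes _    | there v∈' = m≤n⇒m≤1+n (countBelow-strict us v≺v' v∈')
  ... | no  _   | no  _    | there v∈' = countBelow-strict us v≺v' v∈'

  countBelow-< : ∀ {v} us → v ∈ˡ us → countBelow v us < length us
  countBelow-< us v∈ = filter-notAll (_≺? _) us (Any.map (λ { refl → ≺-irrefl refl }) v∈)

  countBelow-onto : ∀ {us} → AllPairs _≺_ us → ∀ j → j < length us →
                    ∃ λ v → v ∈ˡ us × countBelow v us ≡ j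
  countBelow-onto {u ∷ us} (u≺us ∷ _) zero _ =
    u , here refl , cong length (filter-none (_≺? u) (≺-irrefl refl ∷ All.map ≺-asym u≺us))
  countBelow-onto {u ∷ us} (u≺us ∷ inc) (suc j) (s≤s j<) with countBelow-onto inc j j<
  ... | v , v∈ , below≡j =
    v , there v∈ , trans (cong length (filter-accept (_≺? v) (All.lookup u≺us v∈))) (cong suc below≡j)

  values : {X : Set} → (X → A) → List X → List A
  values c = foldr (insert ∘ c) []

  values-increasing : ∀ {X} (c : X → A) xs → AllPairs _≺_ (values c xs)
  values-increasing c []       = []
  values-increasing c (x ∷ xs) = insert-increasing (c x) (values c xs) (values-increasing c xs)

  ∈-values⁺ : ∀ {X} (c : X → A) {x xs} → x ∈ˡ xs → c x ∈ˡ values c xs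
  ∈-values⁺ c {xs = y ∷ xs} (here refl) = ∈-insert⁺ˡ (c y) (values c xs)
  ∈-values⁺ c {xs = y ∷ xs} (there x∈)  = ∈-insert⁺ʳ (c y) (values c xs) (∈-values⁺ c x∈)

  ∈-values⁻ : ∀ {X} (c : X → A) {v} xs → v ∈ˡ values c xs → ∃ λ x → v ≡ c x
  ∈-values⁻ c (y ∷ xs) v∈ with ∈-insert⁻ (c y) (values c xs) v∈
  ... | inj₁ v≡cy = y , v≡cy
  ... | inj₂ v∈'  = ∈-values⁻ c xs v∈'

module DenseRanking {A : Set} {_≺_ : Rel A 0ℓ} (sto : IsStrictTotalOrder _≡_ _≺_)
                    {X : Set} {enum : List X} (complete : ∀ x → x ∈ˡ enum) where
  open IsStrictTotalOrder sto using (compare)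
  open IncreasingLists sto

  rank : (X → A) → X → ℕ
  rank c x = countBelow (c x) (values c enum)

  width : (X → A) → ℕ
  width c = length (values c enum)

  rank-cong : ∀ c x y → c x ≡ c y → rank c x ≡ rank c y
  rank-cong c _ _ = cong (λ v → countBelow v (values c enum))

  rank-mono-< : ∀ c x y → c x ≺ c y → rank c x < rank c y
  rank-mono-< c x _ cx≺cy = countBelow-strict (values c enum) cx≺cy (∈-values⁺ c (complete x))

  rank-cancel-< : ∀ c x y → rank c x < rank c y → c x ≺ c y
  rank-cancel-< c x y rx<ry with compare (c x) (c y)
  ... | tri< cx≺cy _ _ = cx≺cy
  ... | tri≈ _ cx≡cy _ = ⊥-elim (ℕ.<-irrefl (rank-cong c x y cx≡cy) rx<ry)
  ... | tri> _ _ cy≺cx = ⊥-elim (ℕ.<-asym rx<ry (rank-mono-< c y x cy≺cx))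

  rank-dense : ∀ c → Dense (rank c) (width c)
  rank-dense c = (λ x → countBelow-< (values c enum) (∈-values⁺ c (complete x))) , onto
    where
      onto : ∀ t → t < width c → ∃ λ x → rank c x ≡ t
      onto t t< with countBelow-onto (values-increasing c enum) t t<
      ... | v , v∈ , below≡t with ∈-values⁻ c enum v∈
      ...   | x , refl = x , below≡t

module _ {m : ℕ} where

  InPart : List (Subset m) → ℕ → Fin m → Set
  InPart []      _       _ = ⊥
  InPart (S ∷ B) zero    i = i ∈ S
  InPart (S ∷ B) (suc j) i = InPart B j i

  -- For an i lying in no part, first and last are junk values.
  first : List (Subset m) → Fin m → ℕ
  first []      i = 0
  first (S ∷ B) i with i ∈? S
  ... | yes _ = 0
  ... | no  _ = suc (first B i)

  last : List (Subset m) → Fin m → ℕ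
  last []      i = 0
  last (S ∷ B) i with any? (i ∈?_) B
  ... | yes _ = suc (last B i)
  ... | no  _ = 0

  first-∷-∈ : ∀ {S i} B → i ∈ S → first (S ∷ B) i ≡ 0
  first-∷-∈ {S} {i} _ i∈S with i ∈? S
  ... | yes _   = refl
  ... | no  i∉S = ⊥-elim (i∉S i∈S)

  first-∷-∉ : ∀ {S i} B → i ∉ S → first (S ∷ B) i ≡ suc (first B i)
  first-∷-∉ {S} {i} _ i∉S with i ∈? S
  ... | yes i∈S = ⊥-elim (i∉S i∈S)
  ... | no  _   = refl

  last-∷-Any : ∀ {S i} B → Any (i ∈_) B → last (S ∷ B) i ≡ suc (last B i)
  last-∷-Any {i = i} B i∈B with any? (i ∈?_) B
  ... | yes _    = refl
  ... | no  i∉B  = ⊥-elim (i∉B i∈B)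

  last-∷-¬Any : ∀ {S i} B → ¬ Any (i ∈_) B → last (S ∷ B) i ≡ 0
  last-∷-¬Any {i = i} B i∉B with any? (i ∈?_) B
  ... | yes i∈B = ⊥-elim (i∉B i∈B)
  ... | no  _   = refl

  last-∷-head : ∀ {S T i} B → last (S ∷ B) i ≡ last (T ∷ B) i
  last-∷-head {i = i} B with any? (i ∈?_) B
  ... | yes _ = refl
  ... | no  _ = refl

  InPart⇒Any : ∀ B {j i} → InPart B j i → Any (i ∈_) B
  InPart⇒Any (S ∷ B) {zero}  i∈S = here i∈S
  InPart⇒Any (S ∷ B) {suc j} i∈B = there (InPart⇒Any B i∈B)

  InPart-< : ∀ B {j i} → InPart B j i → j < length B
  InPart-< (S ∷ B) {zero}  _   = z<s
  InPart-< (S ∷ B) {suc j} i∈B = s≤s (InPart-< B i∈B)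

  InPart-first : ∀ B {i} → Any (i ∈_) B → InPart B (first B i) i
  InPart-first (S ∷ B) (here i∈S) rewrite first-∷-∈ B i∈S = i∈S
  InPart-first (S ∷ B) {i} (there i∈B) with i ∈? S
  ... | yes i∈S = i∈S
  ... | no  _   = InPart-first B i∈B

  InPart-last : ∀ B {i} → Any (i ∈_) B → InPart B (last B i) i
  InPart-last (S ∷ B) {i} i∈SB with any? (i ∈?_) B | i∈SB
  ... | yes i∈B | _           = InPart-last B i∈B
  ... | no  _   | here i∈S    = i∈S
  ... | no  i∉B | there i∈B   = ⊥-elim (i∉B i∈B)

  first-≤ : ∀ B {j i} → InPart B j i → first B i ≤ j
  first-≤ (S ∷ B) {zero}  i∈S rewrite first-∷-∈ B i∈S = z≤n
  first-≤ (S ∷ B) {suc j} {i} i∈B with i ∈? S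
  ... | yes _ = z≤n
  ... | no  _ = s≤s (first-≤ B i∈B)

  ≤-last : ∀ B {j i} → InPart B j i → j ≤ last B i
  ≤-last (S ∷ B) {zero}  _   = z≤n
  ≤-last (S ∷ B) {suc j} i∈B rewrite last-∷-Any {S = S} B (InPart⇒Any B i∈B) = s≤s (≤-last B i∈B)

  Any-merge⁺ : ∀ xs {a b ys} {i : Fin m} →
               Any (i ∈_) (xs ++ a ∷ b ∷ ys) → Any (i ∈_) (xs ++ (a ∪ b) ∷ ys)
  Any-merge⁺ []       (here i∈a)         = here (x∈p∪q⁺ (inj₁ i∈a))
  Any-merge⁺ []       (there (here i∈b)) = here (x∈p∪q⁺ (inj₂ i∈b))
  Any-merge⁺ []       (there (there i∈)) = there i∈
  Any-merge⁺ (S ∷ xs) (here i∈S)         = here i∈S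
  Any-merge⁺ (S ∷ xs) (there i∈)         = there (Any-merge⁺ xs i∈)

  Any-merge⁻ : ∀ xs {a b ys} {i : Fin m} →
               Any (i ∈_) (xs ++ (a ∪ b) ∷ ys) → Any (i ∈_) (xs ++ a ∷ b ∷ ys)
  Any-merge⁻ []       {a} {b} (here i∈a∪b) = [ here , there ∘ here ]′ (x∈p∪q⁻ a b i∈a∪b)
  Any-merge⁻ []       (there i∈)           = there (there i∈)
  Any-merge⁻ (S ∷ xs) (here i∈S)           = here i∈S
  Any-merge⁻ (S ∷ xs) (there i∈)           = there (Any-merge⁻ xs i∈)

  first-merge : ∀ xs {a b ys i} →
                first (xs ++ (a ∪ b) ∷ ys) i ≡ collapse (length xs) (first (xs ++ a ∷ b ∷ ys) i)
  first-merge [] {a} {b} {ys} {i} with i ∈? a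
  ... | yes i∈a = first-∷-∈ ys (p⊆p∪q b i∈a)
  ... | no  i∉a with i ∈? b
  ...   | yes i∈b = first-∷-∈ ys (q⊆p∪q a b i∈b)
  ...   | no  i∉b = first-∷-∉ ys ([ i∉a , i∉b ]′ ∘ x∈p∪q⁻ a b)
  first-merge (S ∷ xs) {i = i} with i ∈? S
  ... | yes _ = refl
  ... | no  _ = cong suc (first-merge xs)

  last-merge : ∀ xs {a b ys i} →
               last (xs ++ (a ∪ b) ∷ ys) i ≡ collapse (length xs) (last (xs ++ a ∷ b ∷ ys) i)
  last-merge [] {a} {b} {ys} {i} = case any? (i ∈?_) (b ∷ ys) of λ where
    (yes i∈bys) → trans (last-∷-head {S = a ∪ b} {T = b} ys)
                        (cong (collapse 0) (sym (last-∷-Any {S = a} (b ∷ ys) i∈bys)))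
    (no  i∉bys) → trans (last-∷-¬Any {S = a ∪ b} ys (i∉bys ∘ there))
                        (cong (collapse 0) (sym (last-∷-¬Any {S = a} (b ∷ ys) i∉bys)))
  last-merge (S ∷ xs) {a} {b} {ys} {i}
    with any? (i ∈?_) (xs ++ (a ∪ b) ∷ ys) | any? (i ∈?_) (xs ++ a ∷ b ∷ ys)
  ... | yes _   | yes _   = cong suc (last-merge xs)
  ... | no  _   | no  _   = refl
  ... | yes i∈  | no  i∉  = ⊥-elim (i∉ (Any-merge⁻ xs i∈))
  ... | no  i∉  | yes i∈  = ⊥-elim (i∉ (Any-merge⁺ xs i∈))

module _ {n : ℕ} where

  occ-∷-∈ : ∀ {S : Subset (suc n)} {i} B → i ∈ S → occ i (S ∷ B) ≡ suc (occ i B)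
  occ-∷-∈ {i = i} _ i∈S = cong length (filter-accept (i ∈?_) i∈S)

  occ-∷-∉ : ∀ {S : Subset (suc n)} {i} B → i ∉ S → occ i (S ∷ B) ≡ occ i B
  occ-∷-∉ {i = i} _ i∉S = cong length (filter-reject (i ∈?_) i∉S)

  Any⇒1≤occ : ∀ {i : Fin (suc n)} B → Any (i ∈_) B → 1 ≤ occ i B
  Any⇒1≤occ {i} _ = filter-some (i ∈?_)

  ¬Any⇒occ≡0 : ∀ {i : Fin (suc n)} B → ¬ Any (i ∈_) B → occ i B ≡ 0
  ¬Any⇒occ≡0 {i} B i∉B = cong length (filter-none (i ∈?_) (¬Any⇒All¬ B i∉B))

  1≤occ⇒Any : ∀ {i : Fin (suc n)} B → 1 ≤ occ i B → Any (i ∈_) B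
  1≤occ⇒Any {i} B 1≤occ with any? (i ∈?_) B
  ... | yes i∈B = i∈B
  ... | no  i∉B = ⊥-elim (ℕ.<-irrefl (sym (¬Any⇒occ≡0 B i∉B)) 1≤occ)

  1<occ-∷ : ∀ {S : Subset (suc n)} {i} B → i ∈ S → Any (i ∈_) B → 1 < occ i (S ∷ B)
  1<occ-∷ B i∈S i∈B = subst (1 <_) (sym (occ-∷-∈ B i∈S)) (s≤s (Any⇒1≤occ B i∈B))

  occ≤1⇒≡last : ∀ B {j} {i : Fin (suc n)} → occ i B ≤ 1 → InPart B j i → j ≡ last B i
  occ≤1⇒≡last (S ∷ B) {zero} {i} o≤1 i∈S with any? (i ∈?_) B
  ... | no  _   = refl
  ... | yes i∈B = ⊥-elim (ℕ.≤⇒≯ o≤1 (1<occ-∷ B i∈S i∈B))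
  occ≤1⇒≡last (S ∷ B) {suc j} {i} o≤1 i∈B = case i ∈? S of λ where
    (yes i∈S) → ⊥-elim (ℕ.≤⇒≯ o≤1 (1<occ-∷ B i∈S (InPart⇒Any B i∈B)))
    (no  i∉S) → trans (cong suc (occ≤1⇒≡last B (subst (_≤ 1) (occ-∷-∉ B i∉S) o≤1) i∈B))
                      (sym (last-∷-Any {S = S} B (InPart⇒Any B i∈B)))

  occ≤2⇒first⊎last : ∀ B {j} {i : Fin (suc n)} → occ i B ≤ 2 → InPart B j i →
                     j ≡ first B i ⊎ j ≡ last B i
  occ≤2⇒first⊎last (S ∷ B) {zero}  _ i∈S = inj₁ (sym (first-∷-∈ B i∈S))
  occ≤2⇒first⊎last (S ∷ B) {suc j} {i} o≤2 i∈B = case i ∈? S of λ where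
      (yes i∈S) → let occ≤1 = s≤s⁻¹ (subst (_≤ 2) (occ-∷-∈ B i∈S) o≤2) in
                  inj₂ (trans (cong suc (occ≤1⇒≡last B occ≤1 i∈B)) (sym last≡))
      (no  i∉S) → Sum.map (λ e → trans (cong suc e) (sym (first-∷-∉ B i∉S))) (λ e → trans (cong suc e) (sym last≡))
                          (occ≤2⇒first⊎last B (subst (_≤ 2) (occ-∷-∉ B i∉S) o≤2) i∈B)
    where
      last≡ : last (S ∷ B) i ≡ suc (last B i)
      last≡ = last-∷-Any {S = S} B (InPart⇒Any B i∈B)

  single-position⇒occ≤1 : ∀ B {i : Fin (suc n)} {a} → (∀ {j} → InPart B j i → j ≡ a) → occ i B ≤ 1
  single-position⇒occ≤1 []      _    = z≤n
  single-position⇒occ≤1 (S ∷ B) {i} only with i ∈? S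
  ... | yes i∈S = s≤s (ℕ.≤-reflexive (¬Any⇒occ≡0 B λ i∈B →
                    ℕ.0≢1+n (trans (only {0} i∈S) (sym (only {suc _} (InPart-first B i∈B))))))
  ... | no  _   = single-position⇒occ≤1 B (λ i∈B → cong pred (only {suc _} i∈B))

  two-positions⇒occ≤2 : ∀ B {i : Fin (suc n)} {a b} → (∀ {j} → InPart B j i → j ≡ a ⊎ j ≡ b) →
                        occ i B ≤ 2
  two-positions⇒occ≤2 []      _ = z≤n
  two-positions⇒occ≤2 (S ∷ B) {i} {a} {b} within with i ∈? S
  ... | no  _   = two-positions⇒occ≤2 B (λ i∈B → Sum.map (cong pred) (cong pred) (within {suc _} i∈B))
  ... | yes i∈S = s≤s (single-position⇒occ≤1 B (proj₂ later))
    where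
      later : ∃ λ c → ∀ {j} → InPart B j i → j ≡ c
      later with within {0} i∈S
      ... | inj₁ 0≡a = pred b , λ i∈B →
              [ (λ 1+j≡a → ⊥-elim (ℕ.0≢1+n (trans 0≡a (sym 1+j≡a)))) , cong pred ]′ (within {suc _} i∈B)
      ... | inj₂ 0≡b = pred a , λ i∈B →
              [ cong pred , (λ 1+j≡b → ⊥-elim (ℕ.0≢1+n (trans 0≡b (sym 1+j≡b)))) ]′ (within {suc _} i∈B)

pattern Z i = inj₁ i
pattern W i = inj₂ i

Coord : ℕ → Set
Coord m = Fin m ⊎ Fin m

module _ {m : ℕ} where

  subset : {P : Pred (Fin m) 0ℓ} → Decidable P → Subset m
  subset P? = tabulate (does ∘ P?)

  ∈-subset⁺ : ∀ {P : Pred (Fin m) 0ℓ} (P? : Decidable P) {i} → P i → i ∈ subset P?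
  ∈-subset⁺ P? {i} Pi = lookup⇒[]= i _ (trans (lookup∘tabulate (does ∘ P?) i) (dec-true (P? i) Pi))

  ∈-subset⁻ : ∀ {P : Pred (Fin m) 0ℓ} (P? : Decidable P) {i} → i ∈ subset P? → P i
  ∈-subset⁻ P? {i} i∈ with P? i | trans (sym (lookup∘tabulate (does ∘ P?) i)) ([]=⇒lookup i∈)
  ... | yes Pi | _ = Pi
  ... | no  _  | ()

  position : List (Subset m) → Coord m → ℕ
  position B (Z i) = last B i
  position B (W i) = first B i

  Z≥W : (Coord m → ℕ) → Set
  Z≥W r = ∀ i → r (W i) ≤ r (Z i)

  AtLevel : (Coord m → ℕ) → ℕ → Fin m → Set
  AtLevel r t i = r (Z i) ≡ t ⊎ r (W i) ≡ t

  atLevel? : ∀ r t → Decidable (AtLevel r t)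
  atLevel? r t i = (r (Z i) ≟ t) ⊎-dec (r (W i) ≟ t)

  level : (Coord m → ℕ) → ℕ → Subset m
  level r t = subset (atLevel? r t)

  ∈-level⁺ : ∀ r {t i} → AtLevel r t i → i ∈ level r t
  ∈-level⁺ r {t} = ∈-subset⁺ (atLevel? r t)

  ∈-level⁻ : ∀ r {t i} → i ∈ level r t → AtLevel r t i
  ∈-level⁻ r {t} = ∈-subset⁻ (atLevel? r t)

  levels : (Coord m → ℕ) → ℕ → List (Subset m)
  levels r = applyUpTo (level r)

  position-merge : ∀ xs {a b ys} x →
                   position (xs ++ (a ∪ b) ∷ ys) x ≡ collapse (length xs) (position (xs ++ a ∷ b ∷ ys) x)
  position-merge xs (Z i) = last-merge xs
  position-merge xs (W i) = first-merge xs

  merge⇒coarser : ∀ {B' B : List (Subset m)} → MergeStep B' B → Coarser (position B) (position B')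
  merge⇒coarser (xs , _ , _ , _ , refl , refl) x y lt =
    collapse-cancel-< (length xs) (subst₂ _<_ (position-merge xs x) (position-merge xs y) lt)

  merges⇒coarser : ∀ {B' B : List (Subset m)} → Star MergeStep B' B → Coarser (position B) (position B')
  merges⇒coarser ε              = λ _ _ lt → lt
  merges⇒coarser (step ◅ steps) = Coarser-trans (merges⇒coarser steps) (merge⇒coarser step)

  mergeAt : ℕ → (ℕ → Subset m) → ℕ → Subset m
  mergeAt zero    F zero    = F 0 ∪ F 1
  mergeAt zero    F (suc t) = F (suc (suc t))
  mergeAt (suc j) F zero    = F 0
  mergeAt (suc j) F (suc t) = mergeAt j (F ∘ suc) t

  ∈-mergeAt : ∀ j F t {i} → i ∈ mergeAt j F t ⇔ (∃ λ u → collapse j u ≡ t × i ∈ F u)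
  ∈-mergeAt zero F zero = mk⇔
    (λ i∈ → [ (λ i∈F₀ → 0 , refl , i∈F₀) , (λ i∈F₁ → 1 , refl , i∈F₁) ]′ (x∈p∪q⁻ (F 0) (F 1) i∈))
    λ { (0 , _ , i∈F₀)      → x∈p∪q⁺ (inj₁ i∈F₀)
      ; (1 , _ , i∈F₁)      → x∈p∪q⁺ (inj₂ i∈F₁)
      ; (suc (suc _) , () , _) }
  ∈-mergeAt zero F (suc t) =
    mk⇔ (λ i∈ → suc (suc t) , refl , i∈) λ { (zero , () , _) ; (suc _ , refl , i∈) → i∈ }
  ∈-mergeAt (suc j) F zero =
    mk⇔ (λ i∈ → 0 , refl , i∈) λ { (zero , _ , i∈) → i∈ ; (suc _ , () , _) }
  ∈-mergeAt (suc j) F (suc t) {i} = mk⇔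
    (λ i∈ → let (u , c≡t , i∈F) = Equivalence.to ih i∈ in suc u , cong suc c≡t , i∈F)
    λ { (zero , () , _) ; (suc u , c≡t , i∈F) → Equivalence.from ih (u , ℕ.suc-injective c≡t , i∈F) }
    where
      ih = ∈-mergeAt j (F ∘ suc) t {i}

  reduce-∈-level : ∀ r x → reduce x ∈ level r (r x)
  reduce-∈-level r (Z i) = ∈-level⁺ r (inj₁ refl)
  reduce-∈-level r (W i) = ∈-level⁺ r (inj₂ refl)

  ∈-level-∘ : ∀ h r t {i} → i ∈ level (h ∘ r) t ⇔ (∃ λ u → h u ≡ t × i ∈ level r u)
  ∈-level-∘ h r t {i} = mk⇔
    (λ i∈ → [ (λ e → r (Z i) , e , reduce-∈-level r (Z i)) , (λ e → r (W i) , e , reduce-∈-level r (W i)) ]′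
              (∈-level⁻ (h ∘ r) i∈))
    (λ (u , hu≡t , i∈) → ∈-level⁺ (h ∘ r) (Sum.map (via hu≡t) (via hu≡t) (∈-level⁻ r i∈)))
    where
      via : ∀ {u v} → h u ≡ t → v ≡ u → h v ≡ t
      via hu≡t v≡u = trans (cong h v≡u) hu≡t

  level-collapse : ∀ j r t → level (collapse j ∘ r) t ≡ mergeAt j (level r) t
  level-collapse j r t = ⊆-antisym
    (Equivalence.from (∈-mergeAt j (level r) t) ∘ Equivalence.to (∈-level-∘ (collapse j) r t))
    (Equivalence.from (∈-level-∘ (collapse j) r t) ∘ Equivalence.to (∈-mergeAt j (level r) t))

  level-cong : ∀ {r s : Coord m → ℕ} → (∀ x → r x ≡ s x) → ∀ t → level r t ≡ level s t
  level-cong {r} {s} r≗s t = ⊆-antisym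
    (∈-level⁺ s ∘ Sum.map (trans (sym (r≗s _))) (trans (sym (r≗s _))) ∘ ∈-level⁻ r)
    (∈-level⁺ r ∘ Sum.map (trans (r≗s _)) (trans (r≗s _)) ∘ ∈-level⁻ s)

  applyUpTo-cong : ∀ {A : Set} {f g : ℕ → A} → (∀ t → f t ≡ g t) → ∀ k → applyUpTo f k ≡ applyUpTo g k
  applyUpTo-cong f≗g zero    = refl
  applyUpTo-cong f≗g (suc k) = cong₂ _∷_ (f≗g 0) (applyUpTo-cong (f≗g ∘ suc) k)

  levels-cong : ∀ {r s : Coord m → ℕ} {k k'} → (∀ x → r x ≡ s x) → k ≡ k' → levels r k ≡ levels s k'
  levels-cong r≗s refl = applyUpTo-cong (level-cong r≗s) _

  MergeStep-∷ : ∀ {S : Subset m} {B' B} → MergeStep B' B → MergeStep (S ∷ B') (S ∷ B)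
  MergeStep-∷ {S} (xs , a , b , ys , refl , refl) = S ∷ xs , a , b , ys , refl , refl

  mergeAt-step : ∀ (F : ℕ → Subset m) {j k} → j < k →
                 MergeStep (applyUpTo F (suc k)) (applyUpTo (mergeAt j F) k)
  mergeAt-step F {zero}  {suc k} _         = [] , F 0 , F 1 , applyUpTo (F ∘ suc ∘ suc) k , refl , refl
  mergeAt-step F {suc j} {suc k} (s≤s j<k) = MergeStep-∷ (mergeAt-step (F ∘ suc) j<k)

  levels-merge : ∀ r {j k} → j < k → MergeStep (levels r (suc k)) (levels (collapse j ∘ r) k)
  levels-merge r {j} {k} j<k =
    subst (MergeStep _) (sym (applyUpTo-cong (level-collapse j r) k)) (mergeAt-step (level r) j<k)

  InPart-applyUpTo⁺ : ∀ (F : ℕ → Subset m) {k j i} → j < k → i ∈ F j → InPart (applyUpTo F k) j i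
  InPart-applyUpTo⁺ F {suc k} {zero}  _         i∈ = i∈
  InPart-applyUpTo⁺ F {suc k} {suc j} (s≤s j<k) i∈ = InPart-applyUpTo⁺ (F ∘ suc) {k} j<k i∈

  InPart-applyUpTo⁻ : ∀ (F : ℕ → Subset m) {k j i} → InPart (applyUpTo F k) j i → i ∈ F j
  InPart-applyUpTo⁻ F {suc k} {zero}  i∈ = i∈
  InPart-applyUpTo⁻ F {suc k} {suc j} i∈ = InPart-applyUpTo⁻ (F ∘ suc) {k} i∈

  InPart-levels⁺ : ∀ r {k} x → r x < k → InPart (levels r k) (r x) (reduce x)
  InPart-levels⁺ r x rx<k = InPart-applyUpTo⁺ (level r) rx<k (reduce-∈-level r x)

  InPart-levels⁻ : ∀ r {k j i} → InPart (levels r k) j i → AtLevel r j i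
  InPart-levels⁻ r {k} i∈ = ∈-level⁻ r (InPart-applyUpTo⁻ (level r) {k} i∈)

  applyUpTo-InPart : ∀ (F : ℕ → Subset m) B →
                     (∀ {j i} → InPart B j i → i ∈ F j) → (∀ {j i} → i ∈ F j → InPart B j i) →
                     applyUpTo F (length B) ≡ B
  applyUpTo-InPart F []      _  _    = refl
  applyUpTo-InPart F (S ∷ B) to from =
    cong₂ _∷_ (⊆-antisym (from {0}) (to {0})) (applyUpTo-InPart (F ∘ suc) B (to {suc _}) (from {suc _}))

  applyUpTo-nonempty : ∀ (F : ℕ → Subset m) k → (∀ t → t < k → Nonempty (F t)) →
                       AllNonempty (applyUpTo F k)
  applyUpTo-nonempty F zero    _  = []
  applyUpTo-nonempty F (suc k) ne =
    ne 0 z<s ∷ applyUpTo-nonempty (F ∘ suc) k (λ t t<k → ne (suc t) (s≤s t<k))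

  AllNonempty-InPart : ∀ {B : List (Subset m)} → AllNonempty B →
                       ∀ {j} → j < length B → ∃ λ i → InPart B j i
  AllNonempty-InPart (ne ∷ _)   {zero}  _         = ne
  AllNonempty-InPart (_ ∷ nes) {suc j} (s≤s j<k) = AllNonempty-InPart nes j<k

  position-levels : ∀ {r k} → Dense r k → Z≥W r → ∀ x → position (levels r k) x ≡ r x
  position-levels {r} {k} (bounded , _) z≥w (Z i) =
    ℕ.≤-antisym (maximal (InPart-last B (InPart⇒Any B atZ))) (≤-last B atZ)
    where
      B = levels r k
      atZ : InPart B (r (Z i)) i
      atZ = InPart-levels⁺ r (Z i) (bounded (Z i))
      maximal : ∀ {j} → InPart (levels r k) j i → j ≤ r (Z i)
      maximal = [ ℕ.≤-reflexive ∘ sym , (λ e → subst (_≤ r (Z i)) e (z≥w i)) ]′ ∘ InPart-levels⁻ r {k}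
  position-levels {r} {k} (bounded , _) z≥w (W i) =
    ℕ.≤-antisym (first-≤ B atW) (minimal (InPart-first B (InPart⇒Any B atW)))
    where
      B = levels r k
      atW : InPart B (r (W i)) i
      atW = InPart-levels⁺ r (W i) (bounded (W i))
      minimal : ∀ {j} → InPart (levels r k) j i → r (W i) ≤ j
      minimal = [ (λ e → subst (r (W i) ≤_) e (z≥w i)) , ℕ.≤-reflexive ]′ ∘ InPart-levels⁻ r {k}

  coordinates : List (Coord m)
  coordinates = map Z (allFin m) ++ map W (allFin m)

  ∈-coordinates : ∀ x → x ∈ˡ coordinates
  ∈-coordinates (Z i) = ∈-++⁺ˡ (∈-map⁺ Z (∈-allFin i))
  ∈-coordinates (W i) = ∈-++⁺ʳ (map Z (allFin m)) (∈-map⁺ W (∈-allFin i))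

  ∃-coordinate? : ∀ {P : Coord m → Set} → Decidable P → Dec (∃ P)
  ∃-coordinate? P? = Dec.map′ satisfied (λ (x , Px) → lose (∈-coordinates x) Px) (any? P? coordinates)

  -- Merge two adjacent levels of r' that r identifies; if there are none, r' and r coincide.
  coarser⇒merges : ∀ {k' k} {r' r : Coord m → ℕ} → Dense r' k' → Dense r k → Coarser r r' →
                   Star MergeStep (levels r' k') (levels r k)
  coarser⇒merges {zero} {zero}  _              _          _ = ε
  coarser⇒merges {zero} {suc k} (bounded' , _) (_ , onto) _ = ⊥-elim (ℕ.n≮0 (bounded' (proj₁ (onto 0 z<s))))
  coarser⇒merges {suc k'} {k} {r'} {r} dense' dense r⊑r'
    with ∃-coordinate? (λ x → ∃-coordinate? λ y → (suc (r' x) ≟ r' y) ×-dec (r x ≟ r y))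
  ... | yes (x , y , covers , merged) =
    levels-merge r' j<k' ◅ coarser⇒merges (collapse-dense dense' j<k') dense (collapse-coarser r⊑r' covers merged)
    where
      j<k' : r' x < k'
      j<k' = s≤s⁻¹ (subst (_< suc k') (sym covers) (proj₁ dense' y))
  ... | no unmerged = subst (Star MergeStep (levels r' (suc k'))) (levels-cong r'≗r k'≡k) ε
    where
      covered : ∀ x y → suc (r' x) ≡ r' y → r x < r y
      covered x y covers = ℕ.≤∧≢⇒<
        (ℕ.≮⇒≥ λ ry<rx → ℕ.<-asym (r⊑r' y x ry<rx) (ℕ.≤-reflexive covers))
        (λ merged → unmerged (x , y , covers , merged))
      unique = dense-unique dense' dense covered (λ x y covers → r⊑r' x y (ℕ.≤-reflexive covers))
      r'≗r = proj₁ unique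
      k'≡k = proj₂ unique

module _ {n : ℕ} where

  levels-bisequence : ∀ {r : Coord (suc n) → ℕ} {k} → Dense r k → ∀ e → r (Z e) ≡ r (W e) → Bisequence n
  levels-bisequence {r} {k} (bounded , onto) e same =
    bisequence (levels r k) levels-nonempty levels-atLeast1 levels-atMost2 (e , levels-once)
    where
      levels-nonempty : AllNonempty (levels r k)
      levels-nonempty = applyUpTo-nonempty (level r) k λ t t<k →
        let (x , rx≡t) = onto t t<k in reduce x , subst (λ u → reduce x ∈ level r u) rx≡t (reduce-∈-level r x)
      levels-atLeast1 : ∀ i → 1 ≤ occ i (levels r k)
      levels-atLeast1 i =
        Any⇒1≤occ (levels r k) (InPart⇒Any (levels r k) (InPart-levels⁺ r (Z i) (bounded (Z i))))
      levels-atMost2 : ∀ i → occ i (levels r k) ≤ 2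
      levels-atMost2 i = two-positions⇒occ≤2 (levels r k) (Sum.map sym sym ∘ InPart-levels⁻ r {k})
      levels-once : occ e (levels r k) ≡ 1
      levels-once = ℕ.≤-antisym
        (single-position⇒occ≤1 (levels r k) ([ sym , (λ rWe≡j → sym (trans same rWe≡j)) ]′ ∘ InPart-levels⁻ r {k}))
        (levels-atLeast1 e)

module BisequenceProperties {n : ℕ} (B : Bisequence n) where

  P : List (Subset (suc n))
  P = parts B

  occurs : ∀ i → Any (i ∈_) P
  occurs i = 1≤occ⇒Any P (atLeast1 B i)

  InPart⇒first⊎last : ∀ {j i} → InPart P j i → j ≡ first P i ⊎ j ≡ last P i
  InPart⇒first⊎last {i = i} = occ≤2⇒first⊎last P (atMost2 B i)

  once⇒first≡last : ∀ {i} → occ i P ≡ 1 → first P i ≡ last P i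
  once⇒first≡last {i} once = occ≤1⇒≡last P (ℕ.≤-reflexive once) (InPart-first P (occurs i))

  position-Z≥W : Z≥W (position P)
  position-Z≥W i = first-≤ P (InPart-last P (occurs i))

  position-dense : Dense (position P) (length P)
  position-dense = bounded , onto
    where
      bounded : ∀ x → position P x < length P
      bounded (Z i) = InPart-< P (InPart-last P (occurs i))
      bounded (W i) = InPart-< P (InPart-first P (occurs i))
      onto : ∀ t → t < length P → ∃ λ x → position P x ≡ t
      onto t t<len with AllNonempty-InPart (nonempty B) t<len
      ... | i , i∈Pt =
        [ (λ t≡first → W i , sym t≡first) , (λ t≡last → Z i , sym t≡last) ]′ (InPart⇒first⊎last i∈Pt)

  levels-position : levels (position P) (length P) ≡ P
  levels-position = applyUpTo-InPart (level (position P)) P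
    (∈-level⁺ (position P) ∘ [ inj₂ ∘ sym , inj₁ ∘ sym ]′ ∘ InPart⇒first⊎last)
    ([ (λ last≡j → subst (λ j → InPart P j _) last≡j (InPart-last P (occurs _)))
     , (λ first≡j → subst (λ j → InPart P j _) first≡j (InPart-first P (occurs _))) ]′ ∘ ∈-level⁻ (position P))

≤⇒≯ : ∀ {x y : ℚ} → x ≤ℚ y → ¬ y <ℚ x
≤⇒≯ x≤y y<x = ℚ.<-irrefl refl (ℚ.<-≤-trans y<x x≤y)

+-cancelʳ-< : ∀ a {x y : ℚ} → x + a <ℚ y + a → x <ℚ y
+-cancelʳ-< a {x} {y} lt = subst₂ _<ℚ_ (cancel x) (cancel y) (ℚ.+-monoˡ-< (- a) lt)
  where
    cancel : ∀ x → (x + a) - a ≡ x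
    cancel x = solve 2 (λ x a → (x :+ a) :- a := x) refl x a

≤-translate : ∀ c {x y x' y' : ℚ} → x + c ≡ x' → y + c ≡ y' → x ≤ℚ y → x' ≤ℚ y'
≤-translate c refl refl = ℚ.+-monoˡ-≤ c

toℚ : ℕ → ℚ
toℚ zero    = 0ℚ
toℚ (suc t) = 1ℚ + toℚ t

toℚ-<-suc : ∀ t → toℚ t <ℚ toℚ (suc t)
toℚ-<-suc t = subst₂ _<ℚ_ (ℚ.+-identityˡ (toℚ t)) refl (ℚ.+-monoˡ-< (toℚ t) (ℚ.positive⁻¹ 1ℚ))

toℚ-mono-< : ∀ {t u} → t < u → toℚ t <ℚ toℚ u
toℚ-mono-< {t} {suc u} (s≤s t≤u) with ℕ.m≤n⇒m<n∨m≡n t≤u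
... | inj₁ t<u  = ℚ.<-trans (toℚ-mono-< t<u) (toℚ-<-suc u)
... | inj₂ refl = toℚ-<-suc t

toℚ-cancel-< : ∀ {t u} → toℚ t <ℚ toℚ u → t < u
toℚ-cancel-< {t} {u} lt with ℕ.<-cmp t u
... | tri< t<u _ _ = t<u
... | tri≈ _ refl _ = ⊥-elim (ℚ.<-irrefl refl lt)
... | tri> _ _ u<t = ⊥-elim (ℚ.<-asym lt (toℚ-mono-< u<t))

module _ {n : ℕ} where

  open DenseRanking ℚ.<-isStrictTotalOrder (∈-coordinates {suc n})

  chartRank : Fin (suc n) → Point n → Coord (suc n) → ℕ
  chartRank k p = rank (coord k p)

  chartRank-Z≡W : ∀ k p → chartRank k p (Z k) ≡ chartRank k p (W k)
  chartRank-Z≡W k (z , w) =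
    rank-cong (coord k (z , w)) (Z k) (W k) (trans (ℚ.+-inverseʳ (z k)) (sym (ℚ.+-inverseʳ (w k))))

  closedCell⇔coarser : ∀ k p q → ClosedCell k p q ⇔ Coarser (chartRank k q) (chartRank k p)
  closedCell⇔coarser k p q = mk⇔ to from
    where
      cp = coord k p
      cq = coord k q
      to : ClosedCell k p q → Coarser (chartRank k q) (chartRank k p)
      to cell x y rx<ry with ℚ.<-cmp (cp x) (cp y) | rank-cancel-< cq x y rx<ry
      ... | tri< cpx<cpy _ _ | _       = rank-mono-< cp x y cpx<cpy
      ... | tri≈ _ cpx≡cpy _ | cqx<cqy = ⊥-elim (ℚ.<-irrefl (proj₂ (cell x y) cpx≡cpy) cqx<cqy)
      ... | tri> _ _ cpy<cpx | cqx<cqy = ⊥-elim (≤⇒≯ (proj₁ (cell y x) cpy<cpx) cqx<cqy)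
      from : Coarser (chartRank k q) (chartRank k p) → ClosedCell k p q
      from coarse x y = below , equal
        where
          reflects : ∀ x y → cq x <ℚ cq y → cp x <ℚ cp y
          reflects x y = rank-cancel-< cp x y ∘ coarse x y ∘ rank-mono-< cq x y
          below : cp x <ℚ cp y → cq x ≤ℚ cq y
          below cpx<cpy = ℚ.≮⇒≥ (ℚ.<-asym cpx<cpy ∘ reflects y x)
          equal : cp x ≡ cp y → cq x ≡ cq y
          equal cpx≡cpy with ℚ.<-cmp (cq x) (cq y)
          ... | tri< cqx<cqy _ _ = ⊥-elim (ℚ.<-irrefl cpx≡cpy (reflects x y cqx<cqy))
          ... | tri≈ _ cqx≡cqy _ = cqx≡cqy
          ... | tri> _ _ cqy<cqx = ⊥-elim (ℚ.<-irrefl (sym cpx≡cpy) (reflects y x cqy<cqx))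

  inChart⇒W≤Z : ∀ {k} (q : Point n) → InChart k q → ∀ i → coord k q (W i) ≤ℚ coord k q (Z i)
  inChart⇒W≤Z {k} (z , w) inChart i = ≤-translate (- (z k + w i)) lhs rhs (inChart i)
    where
      lhs : (z k + w k) - (z k + w i) ≡ w k - w i
      lhs = solve 3 (λ zk wk wi → (zk :+ wk) :- (zk :+ wi) := wk :- wi) refl (z k) (w k) (w i)
      rhs : (z i + w i) - (z k + w i) ≡ z i - z k
      rhs = solve 3 (λ zi wi zk → (zi :+ wi) :- (zk :+ wi) := zi :- zk) refl (z i) (w i) (z k)

  W≤Z⇒inChart : ∀ {k} (q : Point n) → (∀ i → coord k q (W i) ≤ℚ coord k q (Z i)) → InChart k q
  W≤Z⇒inChart {k} (z , w) W≤Z i = ≤-translate (z k + w i) lhs rhs (W≤Z i)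
    where
      lhs : (w k - w i) + (z k + w i) ≡ z k + w k
      lhs = solve 3 (λ wk wi zk → (wk :- wi) :+ (zk :+ wi) := zk :+ wk) refl (w k) (w i) (z k)
      rhs : (z i - z k) + (z k + w i) ≡ z i + w i
      rhs = solve 3 (λ zi zk wi → (zi :- zk) :+ (zk :+ wi) := zi :+ wi) refl (z i) (z k) (w i)

  inChart-switch : ∀ {k k'} (q : Point n) → InChart k q → coord k q (Z k') ≤ℚ coord k q (W k') →
                   InChart k' q
  inChart-switch {k} {k'} (z , w) inChart Z≤W i =
    ℚ.≤-trans (≤-translate (z k + w k') lhs rhs Z≤W) (inChart i)
    where
      lhs : (z k' - z k) + (z k + w k') ≡ z k' + w k'
      lhs = solve 3 (λ zk' zk wk' → (zk' :- zk) :+ (zk :+ wk') := zk' :+ wk') refl (z k') (z k) (w k')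
      rhs : (w k - w k') + (z k + w k') ≡ z k + w k
      rhs = solve 3 (λ wk wk' zk → (wk :- wk') :+ (zk :+ wk') := zk :+ wk) refl (w k) (w k') (z k)

  chartRank-Z≥W : ∀ {k p} → InChart k p → Z≥W (chartRank k p)
  chartRank-Z≥W {k} {p} inChart i =
    ℕ.≮⇒≥ (≤⇒≯ (inChart⇒W≤Z p inChart i) ∘ rank-cancel-< (coord k p) (Z i) (W i))

  coarser-inChart : ∀ {k p q} → InChart k p → Coarser (chartRank k q) (chartRank k p) → InChart k q
  coarser-inChart {k} {p} {q} inChart q⊑p = W≤Z⇒inChart q λ i → ℚ.≮⇒≥ λ cqZ<cqW →
    ≤⇒≯ (inChart⇒W≤Z p inChart i)
        (rank-cancel-< (coord k p) (Z i) (W i) (q⊑p (Z i) (W i) (rank-mono-< (coord k q) (Z i) (W i) cqZ<cqW)))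

  coord-rebase : ∀ {k k'} (q : Point n) → proj₁ q k + proj₂ q k ≡ proj₁ q k' + proj₂ q k' →
                 ∀ x → coord k' q x ≡ coord k q x - coord k q (Z k')
  coord-rebase {k} {k'} (z , w) _ (Z a) =
    solve 3 (λ za zk' zk → za :- zk' := (za :- zk) :- (zk' :- zk)) refl (z a) (z k') (z k)
  coord-rebase {k} {k'} (z , w) same (W a) = begin
    w k' - w a                    ≡⟨ expand ⟩
    ((z k' + w k') - z k') - w a  ≡⟨ cong (λ s → (s - z k') - w a) (sym same) ⟩
    ((z k + w k) - z k') - w a    ≡⟨ regroup ⟩
    (w k - w a) - (z k' - z k)    ∎
    where
      open ≡-Reasoning
      expand : w k' - w a ≡ ((z k' + w k') - z k') - w a
      expand = solve 3 (λ zk' wk' wa → wk' :- wa := ((zk' :+ wk') :- zk') :- wa) refl (z k') (w k') (w a)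
      regroup : ((z k + w k) - z k') - w a ≡ (w k - w a) - (z k' - z k)
      regroup = solve 4 (λ zk wk zk' wa → ((zk :+ wk) :- zk') :- wa := (wk :- wa) :- (zk' :- zk))
                        refl (z k) (w k) (z k') (w a)

  chart-change : ∀ {k k' q} → InChart k q → InChart k' q → Coarser (chartRank k' q) (chartRank k q)
  chart-change {k} {k'} {q} inChart inChart' x y r'x<r'y =
    rank-mono-< (coord k q) x y (+-cancelʳ-< (- coord k q (Z k'))
      (subst₂ _<ℚ_ (rebase x) (rebase y) (rank-cancel-< (coord k' q) x y r'x<r'y)))
    where
      rebase = coord-rebase q (ℚ.≤-antisym (inChart k') (inChart' k))

  chartOf : Bisequence n → Fin (suc n)
  chartOf B = proj₁ (someOnce B)

  point : Bisequence n → Point n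
  point B = (λ i → toℚ (last (parts B) i)) , (λ i → - toℚ (first (parts B) i))

  coord-point : ∀ B x →
                coord (chartOf B) (point B) x ≡ toℚ (position (parts B) x) - toℚ (last (parts B) (chartOf B))
  coord-point B (Z a) = refl
  coord-point B (W a) = begin
    - toℚ (first P k) - - toℚ (first P a)  ≡⟨ neg-sub (toℚ (first P k)) (toℚ (first P a)) ⟩
    toℚ (first P a) - toℚ (first P k)      ≡⟨ cong (λ t → toℚ (first P a) - toℚ t) k-once ⟩
    toℚ (first P a) - toℚ (last P k)       ∎
    where
      open ≡-Reasoning
      open BisequenceProperties B
      k = chartOf B
      k-once : first P k ≡ last P k
      k-once = once⇒first≡last (proj₂ (someOnce B))
      neg-sub : ∀ f g → - f - - g ≡ g - f
      neg-sub = solve 2 (λ f g → (:- f) :- (:- g) := g :- f) refl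

  point⊑position : ∀ B → Coarser (chartRank (chartOf B) (point B)) (position (parts B))
  point⊑position B x y lt = toℚ-cancel-< (+-cancelʳ-< (- toℚ (last (parts B) (chartOf B)))
    (subst₂ _<ℚ_ (coord-point B x) (coord-point B y) (rank-cancel-< (coord (chartOf B) (point B)) x y lt)))

  position⊑point : ∀ B → Coarser (position (parts B)) (chartRank (chartOf B) (point B))
  position⊑point B x y lt = rank-mono-< (coord (chartOf B) (point B)) x y
    (subst₂ _<ℚ_ (sym (coord-point B x)) (sym (coord-point B y)) (ℚ.+-monoˡ-< _ (toℚ-mono-< lt)))

  point-inChart : ∀ B → InChart (chartOf B) (point B)
  point-inChart B = W≤Z⇒inChart (point B) λ i → ℚ.≮⇒≥ λ cZ<cW →
    ℕ.≤⇒≯ (position-Z≥W i)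
          (point⊑position B (Z i) (W i) (rank-mono-< (coord (chartOf B) (point B)) (Z i) (W i) cZ<cW))
    where open BisequenceProperties B

  cellCone : ∀ k p → InChart k p → Cone n
  cellCone k p inChart = ClosedCell k p , k , p , inChart , λ _ → mk⇔ id id

  coneOf : Bisequence n → Cone n
  coneOf B = cellCone (chartOf B) (point B) (point-inChart B)

  coneRank : Cone n → Coord (suc n) → ℕ
  coneRank (_ , k , p , _) = chartRank k p

  bisequenceOf : Cone n → Bisequence n
  bisequenceOf (_ , k , p , _) = levels-bisequence (rank-dense (coord k p)) k (chartRank-Z≡W k p)

  position-bisequenceOf : ∀ σ x → position (parts (bisequenceOf σ)) x ≡ coneRank σ x
  position-bisequenceOf (_ , k , p , inChart , _) = position-levels (rank-dense (coord k p)) (chartRank-Z≥W inChart)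

  coneOf-bisequenceOf : ∀ σ → coneOf (bisequenceOf σ) ≅ᶜ σ
  coneOf-bisequenceOf σ@(S , k , p , _ , S⇔cell) =
    (λ q → Equivalence.from (S⇔cell q) ∘ Equivalence.to (same q)) ,
    (λ q → Equivalence.from (same q) ∘ Equivalence.to (S⇔cell q))
    where
      B = bisequenceOf σ
      point⊑p : Coarser (chartRank k (point B)) (chartRank k p)
      point⊑p = Coarser-trans (point⊑position B) (≗⇒Coarser (position-bisequenceOf σ))
      p⊑point : Coarser (chartRank k p) (chartRank k (point B))
      p⊑point = Coarser-trans (≗⇒Coarser (sym ∘ position-bisequenceOf σ)) (position⊑point B)
      same : ∀ q → ClosedCell k (point B) q ⇔ ClosedCell k p q
      same q = mk⇔
        (Equivalence.from (closedCell⇔coarser k p q) ∘ (λ q⊑point → Coarser-trans q⊑point point⊑p) ∘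
         Equivalence.to (closedCell⇔coarser k (point B) q))
        (Equivalence.from (closedCell⇔coarser k (point B) q) ∘ (λ q⊑p → Coarser-trans q⊑p p⊑point) ∘
         Equivalence.to (closedCell⇔coarser k p q))

  parts-bisequenceOf-coneOf : ∀ B → parts (bisequenceOf (coneOf B)) ≡ parts B
  parts-bisequenceOf-coneOf B = trans (levels-cong (proj₁ unique) (proj₂ unique)) levels-position
    where
      open BisequenceProperties B
      unique = dense-unique (rank-dense (coord (chartOf B) (point B))) position-dense
                 (λ x y covers → point⊑position B x y (ℕ.≤-reflexive covers))
                 (λ x y covers → position⊑point B x y (ℕ.≤-reflexive covers))

  ⊆ᶜ⇔≼ : ∀ σ τ → (σ ⊆ᶜ τ) ⇔ (bisequenceOf σ ≼ bisequenceOf τ)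
  ⊆ᶜ⇔≼ σ@(S , k , p , p∈𝒞ₖ , S⇔cell) τ@(T , k' , p' , p'∈𝒞ₖ' , T⇔cell) = mk⇔ to from
    where
      to : σ ⊆ᶜ τ → bisequenceOf σ ≼ bisequenceOf τ
      to σ⊆τ = coarser⇒merges (rank-dense (coord k' p')) (rank-dense (coord k p))
                 (Coarser-trans (chart-change p∈𝒞ₖ' p∈𝒞ₖ) p⊑τ)
        where
          p∈σ : S p
          p∈σ = Equivalence.from (S⇔cell p) (Equivalence.from (closedCell⇔coarser k p p) (λ _ _ lt → lt))
          p⊑τ : Coarser (chartRank k' p) (coneRank τ)
          p⊑τ = Equivalence.to (closedCell⇔coarser k' p' p) (Equivalence.to (T⇔cell p) (σ⊆τ p p∈σ))
          p∈𝒞ₖ' : InChart k' p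
          p∈𝒞ₖ' = coarser-inChart p'∈𝒞ₖ' p⊑τ
      from : bisequenceOf σ ≼ bisequenceOf τ → σ ⊆ᶜ τ
      from merges q q∈σ =
        Equivalence.from (T⇔cell q)
          (Equivalence.from (closedCell⇔coarser k' p' q) (Coarser-trans (chart-change q∈𝒞ₖ q∈𝒞ₖ') q⊑τ))
        where
          σ⊑τ : Coarser (coneRank σ) (coneRank τ)
          σ⊑τ = Coarser-trans (≗⇒Coarser (sym ∘ position-bisequenceOf σ))
                  (Coarser-trans (merges⇒coarser merges) (≗⇒Coarser (position-bisequenceOf τ)))
          q⊑σ : Coarser (chartRank k q) (coneRank σ)
          q⊑σ = Equivalence.to (closedCell⇔coarser k p q) (Equivalence.to (S⇔cell q) q∈σ)
          q⊑τ : Coarser (chartRank k q) (coneRank τ)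
          q⊑τ = Coarser-trans q⊑σ σ⊑τ
          q∈𝒞ₖ : InChart k q
          q∈𝒞ₖ = coarser-inChart p∈𝒞ₖ q⊑σ
          -- Z k' and W k' have equal rank in τ, so not W k' < Z k' at q: k' minimises z + w at q as well.
          q∈𝒞ₖ' : InChart k' q
          q∈𝒞ₖ' = inChart-switch q q∈𝒞ₖ (ℚ.≮⇒≥ λ W<Z →
            ℕ.<-irrefl (sym (chartRank-Z≡W k' p'))
                       (q⊑τ (W k') (Z k') (rank-mono-< (coord k q) (W k') (Z k') W<Z)))

proposition2p10 : (n : ℕ) → 1 ≤ n →
    Σ (Cone n → Bisequence n) λ f → Σ (Bisequence n → Cone n) λ g →
      (∀ σ → g (f σ) ≅ᶜ σ) × (∀ B → parts (f (g B)) ≡ parts B) ×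
      (∀ σ τ → (σ ⊆ᶜ τ) ⇔ (f σ ≼ f τ))
proposition2p10 n _ = bisequenceOf , coneOf , coneOf-bisequenceOf , parts-bisequenceOf-coneOf , ⊆ᶜ⇔≼
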